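{- Let $\mathbf{B}$ be a topological Boolean algebra, $\nabla$ an open filter and $\Delta$ a closed ideal of $\mathbf{B}$, $\mathbf{T}=Tw(\mathbf{B},\nabla,\Delta)$, and suppose $\Gamma(\mathbf{T})=\Lambda(\mathbf{B},\nabla)$. Then: (1) $\boldsymbol{\Gamma}(\mathbf{T})=\langle\Gamma(\mathbf{T});\vee_{\mathcal{G}(\mathbf{B})},\wedge_{\mathcal{G}(\mathbf{B})},\to_{\mathcal{G}(\mathbf{B})},\bot_{\mathcal{G}(\mathbf{B})}\rangle$ is a subalgebra of $\mathcal{G}(\mathbf{B})$; (2) $\mathcal{G}_2(\mathbf{T})=\langle\mathsf{G}_2(\mathbf{T});\vee,\wedge,\to,\bot,\sim\rangle$, with the operations of $\mathcal{G}(\mathbf{B})^{\bowtie}$, is a twist-structure over the Heyting algebra $\boldsymbol{\Gamma}(\mathbf{T})$; more precisely $\mathcal{G}_2(\mathbf{T})=Tw(\boldsymbol{\Gamma}(\mathbf{T}),\nabla_{\mathsf{G}}(\mathbf{T}),\Delta_{\mathsf{G}}(\mathbf{T}))$.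
   Context: A topological Boolean algebra (TBA) is an algebra $\mathbf{B}=\langle B;\vee,\wedge,\to,\bot,\Box\rangle$ whose reduct is a Boolean algebra (top $1$, $\neg a:=a\to\bot$) with $\Box 1=1$, $\Box(a\wedge b)=\Box a\wedge\Box b$, $\Box a\le a$, $\Box a\le\Box\Box a$; $\Diamond a:=\neg\Box\neg a$. $\mathsf{G}(\mathbf{B})=\{a\in B:\Box a=a\}$; $\mathcal{G}(\mathbf{B})$ is the Heyting algebra on $\mathsf{G}(\mathbf{B})$ with $\vee,\wedge,\bot$ of $\mathbf{B}$ and $a\to_{\mathcal{G}(\mathbf{B})}b:=\Box(a\to b)$. For a Heyting algebra $\mathbf{C}$, the full twist-structure $\mathbf{C}^{\bowtie}$ has universe $C\times C$ and operations $(a,b)\vee(c,d)=(a\vee c,b\wedge d)$, $(a,b)\wedge(c,d)=(a\wedge c,b\vee d)$, $(a,b)\to(c,d)=(a\to c,a\wedge d)$, $\bot=(\bot,1)$, $\sim(a,b)=(b,a)$ (for a TBA also $\Box(a,b)=(\Box a,\Diamond b)$, $\Diamond(a,b)=(\Diamond a,\Box b)$); a twist-structure over $\mathbf{C}$ is a subalgebra of $\mathbf{C}^{\bowtie}$ whose first projection is all of $C$; $Tw(\mathbf{C},\nabla,\Delta)$ denotes the subalgebra of $\mathbf{C}^{\bowtie}$ on $\{(a,b)\in C\times C:a\vee b\in\nabla,\ a\wedge b\in\Delta\}$. A filter of a TBA is open if closed under $\Box$; an ideal is closed if closed under $\Diamond$. For $\mathbf{T}=Tw(\mathbf{B},\nabla,\Delta)$: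 $\mathsf{G}_2(\mathbf{T})=\{(a,b)\in\mathbf{T}:\Box a=a,\ \Box b=b\}$, $\Gamma(\mathbf{T})=\pi_1(\mathsf{G}_2(\mathbf{T}))$, $\Lambda(\mathbf{B},\nabla)=\{a\in\mathsf{G}(\mathbf{B}): a\vee\Box\neg a\in\nabla\}$, $\nabla_{\mathsf{G}}(\mathbf{T})=\{a\vee b:(a,b)\in\mathsf{G}_2(\mathbf{T})\}$, $\Delta_{\mathsf{G}}(\mathbf{T})=\{a\wedge b:(a,b)\in\mathsf{G}_2(\mathbf{T})\}$. -}

module Defs where

open import Level using (Level; _⊔_; suc)
open import Algebra.Lattice.Bundles using (BooleanAlgebra)
open import Relation.Unary using (Pred; _∈_)
open import Data.Product using (Σ; _×_; _,_)
open import Function.Bundles using (_⇔_)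

record TBA (c ℓ : Level) : Set (suc (c ⊔ ℓ)) where
  field
    booleanAlgebra : BooleanAlgebra c ℓ
  open BooleanAlgebra booleanAlgebra public
  field
    □      : Carrier → Carrier
    □-cong : ∀ {a b} → a ≈ b → □ a ≈ □ b
    □-⊤    : □ ⊤ ≈ ⊤
    □-∧    : ∀ a b → □ (a ∧ b) ≈ (□ a ∧ □ b)
    □-≤    : ∀ a → (□ a ∧ a) ≈ □ a
    □-≤□□  : ∀ a → (□ a ∧ □ (□ a)) ≈ □ a

  _≤_ : Carrier → Carrier → Set ℓ
  a ≤ b = (a ∧ b) ≈ a

  _⇒_ : Carrier → Carrier → Carrier
  a ⇒ b = ¬ a ∨ b

  ◇ : Carrier → Carrier
  ◇ a = ¬ □ (¬ a)

  G : Pred Carrier ℓ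
  G a = □ a ≈ a

  _⇒G_ : Carrier → Carrier → Carrier
  a ⇒G b = □ (a ⇒ b)

  module _ {p : Level} where
    record IsFilter (F : Pred Carrier p) : Set (c ⊔ ℓ ⊔ p) where
      field
        ⊤∈   : ⊤ ∈ F
        ∧∈   : ∀ {a b} → a ∈ F → b ∈ F → (a ∧ b) ∈ F
        up   : ∀ {a b} → a ∈ F → a ≤ b → b ∈ F

    record IsIdeal (I : Pred Carrier p) : Set (c ⊔ ℓ ⊔ p) where
      field
        ⊥∈   : ⊥ ∈ I
        ∨∈   : ∀ {a b} → a ∈ I → b ∈ I → (a ∨ b) ∈ I
        down : ∀ {a b} → a ∈ I → b ≤ a → b ∈ I

    record IsOpenFilter (F : Pred Carrier p) : Set (c ⊔ ℓ ⊔ p) where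
      field
        isFilter : IsFilter F
        □∈       : ∀ {a} → a ∈ F → □ a ∈ F

    record IsClosedIdeal (I : Pred Carrier p) : Set (c ⊔ ℓ ⊔ p) where
      field
        isIdeal : IsIdeal I
        ◇∈      : ∀ {a} → a ∈ I → ◇ a ∈ I

    Tw : Pred Carrier p → Pred Carrier p → Carrier → Carrier → Set p
    Tw ∇ Δ a b = ((a ∨ b) ∈ ∇) × ((a ∧ b) ∈ Δ)

    G₂ : Pred Carrier p → Pred Carrier p → Carrier → Carrier → Set (ℓ ⊔ p)
    G₂ ∇ Δ a b = Tw ∇ Δ a b × (□ a ≈ a) × (□ b ≈ b)

    Γ : Pred Carrier p → Pred Carrier p → Pred Carrier (c ⊔ ℓ ⊔ p)
    Γ ∇ Δ a = Σ Carrier (λ b → G₂ ∇ Δ a b)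

    Λ : Pred Carrier p → Pred Carrier (ℓ ⊔ p)
    Λ ∇ a = G a × ((a ∨ □ (¬ a)) ∈ ∇)

    ∇G : Pred Carrier p → Pred Carrier p → Pred Carrier (c ⊔ ℓ ⊔ p)
    ∇G ∇ Δ x = Σ Carrier (λ a → Σ Carrier (λ b → G₂ ∇ Δ a b × (x ≈ (a ∨ b))))

    ΔG : Pred Carrier p → Pred Carrier p → Pred Carrier (c ⊔ ℓ ⊔ p)
    ΔG ∇ Δ x = Σ Carrier (λ a → Σ Carrier (λ b → G₂ ∇ Δ a b × (x ≈ (a ∧ b))))

  TwSub : ∀ {q} → Pred Carrier q → Pred Carrier q → Pred Carrier q →
          Carrier → Carrier → Set q
  TwSub C ∇' Δ' a b = (a ∈ C) × (b ∈ C) × ((a ∨ b) ∈ ∇') × ((a ∧ b) ∈ Δ')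

  record IsSubalgebraG {q} (S : Pred Carrier q) : Set (c ⊔ ℓ ⊔ q) where
    field
      ⊆G  : ∀ {a} → a ∈ S → a ∈ G
      ⊥∈  : ⊥ ∈ S
      ∨∈  : ∀ {a b} → a ∈ S → b ∈ S → (a ∨ b) ∈ S
      ∧∈  : ∀ {a b} → a ∈ S → b ∈ S → (a ∧ b) ∈ S
      ⇒∈  : ∀ {a b} → a ∈ S → b ∈ S → (a ⇒G b) ∈ S

  -- A binary relation R (set of pairs) is a subuniverse of 𝒢(B)^⋈ whose first
  -- projection is exactly the set C: i.e. a twist-structure over C.
  record IsTwistOver {q r} (C : Pred Carrier q) (R : Carrier → Carrier → Set r)
         : Set (c ⊔ ℓ ⊔ q ⊔ r) where
    field
      ⊆C×C : ∀ {a b} → R a b → (a ∈ C) × (b ∈ C)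
      π₁-onto : ∀ {a} → a ∈ C → Σ Carrier (λ b → R a b)
      ⊥∈  : R ⊥ ⊤
      ∨∈  : ∀ {a b c d} → R a b → R c d → R (a ∨ c) (b ∧ d)
      ∧∈  : ∀ {a b c d} → R a b → R c d → R (a ∧ c) (b ∨ d)
      ⇒∈  : ∀ {a b c d} → R a b → R c d → R (a ⇒G c) (a ∧ d)
      ∼∈  : ∀ {a b} → R a b → R b a

module Submission where

-- The pairs of open elements in Tw(B, ∇, Δ) are closed under the twist
-- operations.  For ∼ and ⊥ this is immediate, for ∨ it is distributivity
-- together with the filter and ideal properties, and ∧ is the ∼-dual of ∨.
-- For the Heyting implication a ⇒G c = □(¬a ∨ c) the only new ingredient is
-- a ∈ Λ, i.e. a ∨ □¬a ∈ ∇: then (a ∨ □¬a) ∧ (c ∨ d) ≤ □(¬a ∨ c) ∨ (a ∧ d).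
-- Since G₂ is ∼-closed, its two projections coincide with Γ, so closure of
-- G₂ yields both that Γ is a subalgebra of 𝒢(B) and that G₂ is a twist
-- structure over it; the description as Tw(Γ, ∇_G, Δ_G) is a repackaging.

open import Defs
open import Level using (Level)
open import Relation.Unary using (Pred; _∈_; _⊆_)
open import Data.Product using (_×_; _,_)
open import Function.Bundles using (_⇔_; mk⇔; Equivalence)
open import Algebra.Lattice.Bundles using (DistributiveLattice)
import Algebra.Lattice.Properties.Lattice as LatticeProperties
import Algebra.Lattice.Properties.BooleanAlgebra as BooleanAlgebraProperties
import Relation.Binary.Lattice as OrderTheoretic
import Relation.Binary.Lattice.Properties.JoinSemilattice as JoinSemilatticeProperties
import Relation.Binary.Lattice.Properties.MeetSemilattice as MeetSemilatticeProperties
import Relation.Binary.Reasoning.PartialOrder as PartialOrderReasoning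

module DistributiveLatticeOrder {c ℓ} (L : DistributiveLattice c ℓ) where
  open DistributiveLattice L
  open LatticeProperties lattice using (∨-∧-orderTheoreticLattice)
  open OrderTheoretic.Lattice ∨-∧-orderTheoreticLattice public
    using (_≤_; poset; x≤x∨y; y≤x∨y; ∨-least; x∧y≤x; x∧y≤y)
    renaming (refl to ≤-refl; reflexive to ≤-reflexive; trans to ≤-trans; antisym to ≤-antisym)
  open JoinSemilatticeProperties (OrderTheoretic.Lattice.joinSemilattice ∨-∧-orderTheoreticLattice) public
    using (∨-monotonic)
  open MeetSemilatticeProperties (OrderTheoretic.Lattice.meetSemilattice ∨-∧-orderTheoreticLattice) public
    using (∧-monotonic)
  open PartialOrderReasoning poset

  ∧≤∨∧ : ∀ {a b x a' b'} → a ≤ x ∨ a' → b ≤ x ∨ b' → a ∧ b ≤ x ∨ (a' ∧ b')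
  ∧≤∨∧ {a} {b} {x} {a'} {b'} a≤ b≤ = begin
    a ∧ b                ≤⟨ ∧-monotonic a≤ b≤ ⟩
    (x ∨ a') ∧ (x ∨ b')  ≈⟨ sym (∨-distribˡ-∧ x a' b') ⟩
    x ∨ (a' ∧ b')        ∎

  ∨∧≤∨ : ∀ {x a b a' b'} → a ∧ x ≤ a' → b ∧ x ≤ b' → (a ∨ b) ∧ x ≤ a' ∨ b'
  ∨∧≤∨ {x} {a} {b} {a'} {b'} a≤ b≤ = begin
    (a ∨ b) ∧ x        ≈⟨ ∧-distribʳ-∨ x a b ⟩
    (a ∧ x) ∨ (b ∧ x)  ≤⟨ ∨-monotonic a≤ b≤ ⟩
    a' ∨ b'            ∎

module Interior {c ℓ} (𝔹 : TBA c ℓ) where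
  open TBA 𝔹 hiding (_≤_)
  open DistributiveLatticeOrder distributiveLattice public
  open BooleanAlgebraProperties booleanAlgebra using (∧-zeroˡ)

  ⊥≤ : ∀ {x} → ⊥ ≤ x
  ⊥≤ {x} = sym (∧-zeroˡ x)

  □≤ : ∀ {x} → □ x ≤ x
  □≤ {x} = sym (□-≤ x)

  □-monotonic : ∀ {x y} → x ≤ y → □ x ≤ □ y
  □-monotonic {x} {y} x≤y = trans (□-cong x≤y) (□-∧ x y)

  open≤□ : ∀ {x y} → x ∈ G → x ≤ y → x ≤ □ y
  open≤□ {x} x∈G x≤y = ≤-trans (≤-reflexive (sym x∈G)) (□-monotonic x≤y)

  ⊥∈G : ⊥ ∈ G
  ⊥∈G = ≤-antisym □≤ ⊥≤

  □∈G : ∀ x → □ x ∈ G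
  □∈G x = ≤-antisym □≤ (sym (□-≤□□ x))

  ∨∈G : ∀ {a b} → a ∈ G → b ∈ G → (a ∨ b) ∈ G
  ∨∈G a∈G b∈G = ≤-antisym □≤ (∨-least (open≤□ a∈G (x≤x∨y _ _)) (open≤□ b∈G (y≤x∨y _ _)))

  ∧∈G : ∀ {a b} → a ∈ G → b ∈ G → (a ∧ b) ∈ G
  ∧∈G {a} {b} a∈G b∈G = trans (□-∧ a b) (∧-cong a∈G b∈G)

module TwistStructure {c ℓ p} (𝔹 : TBA c ℓ) {∇ Δ : Pred (TBA.Carrier 𝔹) p}
  (∇-isFilter : TBA.IsFilter 𝔹 ∇) (Δ-isIdeal : TBA.IsIdeal 𝔹 Δ) where
  open TBA 𝔹 hiding (_≤_)
  open Interior 𝔹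
  open IsFilter ∇-isFilter using (⊤∈; ∧∈; up)
  open IsIdeal Δ-isIdeal using (down)
  open BooleanAlgebraProperties booleanAlgebra using (∨-identityˡ)
  open PartialOrderReasoning poset

  -- The library order is a ≈ a ∧ b, while filters and ideals use a ∧ b ≈ a.
  ∇-upward : ∀ {a b} → a ∈ ∇ → a ≤ b → b ∈ ∇
  ∇-upward a∈∇ a≤b = up a∈∇ (sym a≤b)

  Δ-downward : ∀ {a b} → a ∈ Δ → b ≤ a → b ∈ Δ
  Δ-downward a∈Δ b≤a = down a∈Δ (sym b≤a)

  G₂-∼ : ∀ {a b} → G₂ ∇ Δ a b → G₂ ∇ Δ b a
  G₂-∼ {a} {b} ((a∨b∈∇ , a∧b∈Δ) , a∈G , b∈G) =
    ( ∇-upward a∨b∈∇ (≤-reflexive (∨-comm a b))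
    , Δ-downward a∧b∈Δ (≤-reflexive (∧-comm b a)) ) , b∈G , a∈G

  G₂-⊥ : G₂ ∇ Δ ⊥ ⊤
  G₂-⊥ = (∇-upward ⊤∈ (y≤x∨y ⊥ ⊤) , Δ-downward (IsIdeal.⊥∈ Δ-isIdeal) (x∧y≤x ⊥ ⊤)) , ⊥∈G , □-⊤

  G₂-∨ : ∀ {a b c d} → G₂ ∇ Δ a b → G₂ ∇ Δ c d → G₂ ∇ Δ (a ∨ c) (b ∧ d)
  G₂-∨ {a} {b} {c} {d} ((a∨b∈∇ , a∧b∈Δ) , a∈G , b∈G) ((c∨d∈∇ , c∧d∈Δ) , c∈G , d∈G) =
    (∇-upward (∧∈ a∨b∈∇ c∨d∈∇) join-bound , Δ-downward (IsIdeal.∨∈ Δ-isIdeal a∧b∈Δ c∧d∈Δ) meet-bound)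
    , ∨∈G a∈G c∈G , ∧∈G b∈G d∈G
    where
    join-bound : (a ∨ b) ∧ (c ∨ d) ≤ (a ∨ c) ∨ (b ∧ d)
    join-bound = ∧≤∨∧ (∨-monotonic (x≤x∨y a c) ≤-refl) (∨-monotonic (y≤x∨y a c) ≤-refl)
    meet-bound : (a ∨ c) ∧ (b ∧ d) ≤ (a ∧ b) ∨ (c ∧ d)
    meet-bound = ∨∧≤∨ (∧-monotonic ≤-refl (x∧y≤x b d)) (∧-monotonic ≤-refl (x∧y≤y b d))

  G₂-∧ : ∀ {a b c d} → G₂ ∇ Δ a b → G₂ ∇ Δ c d → G₂ ∇ Δ (a ∧ c) (b ∨ d)
  G₂-∧ ab cd = G₂-∼ (G₂-∨ (G₂-∼ ab) (G₂-∼ cd))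

  G₂-⇒G : ∀ {a c d} → a ∈ Λ ∇ → G₂ ∇ Δ c d → G₂ ∇ Δ (a ⇒G c) (a ∧ d)
  G₂-⇒G {a} {c} {d} (a∈G , a∨□¬a∈∇) ((c∨d∈∇ , c∧d∈Δ) , c∈G , d∈G) =
    (∇-upward (∧∈ a∨□¬a∈∇ c∨d∈∇) join-bound , Δ-downward c∧d∈Δ meet-bound)
    , □∈G (a ⇒ c) , ∧∈G a∈G d∈G
    where
    join-bound : (a ∨ □ (¬ a)) ∧ (c ∨ d) ≤ (a ⇒G c) ∨ (a ∧ d)
    join-bound = ∧≤∨∧
      (∨-least (y≤x∨y _ a) (≤-trans (□-monotonic (x≤x∨y (¬ a) c)) (x≤x∨y _ a)))
      (∨-monotonic (open≤□ c∈G (y≤x∨y (¬ a) c)) ≤-refl)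
    ¬a-disjoint : ¬ a ∧ (a ∧ d) ≤ ⊥
    ¬a-disjoint = begin
      ¬ a ∧ (a ∧ d)  ≈⟨ sym (∧-assoc (¬ a) a d) ⟩
      (¬ a ∧ a) ∧ d  ≤⟨ x∧y≤x _ d ⟩
      ¬ a ∧ a        ≈⟨ ∧-complementˡ a ⟩
      ⊥              ∎
    meet-bound : (a ⇒G c) ∧ (a ∧ d) ≤ c ∧ d
    meet-bound = begin
      (a ⇒G c) ∧ (a ∧ d)  ≤⟨ ∧-monotonic □≤ ≤-refl ⟩
      (¬ a ∨ c) ∧ (a ∧ d) ≤⟨ ∨∧≤∨ ¬a-disjoint (∧-monotonic ≤-refl (x∧y≤y a d)) ⟩
      ⊥ ∨ (c ∧ d)         ≈⟨ ∨-identityˡ (c ∧ d) ⟩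
      c ∧ d               ∎

  G₂-snd∈Γ : ∀ {a b} → G₂ ∇ Δ a b → b ∈ Γ ∇ Δ
  G₂-snd∈Γ ab = _ , G₂-∼ ab

  Γ⊆G : Γ ∇ Δ ⊆ G
  Γ⊆G (_ , _ , a∈G , _) = a∈G

  ∇G⊆∇ : ∇G ∇ Δ ⊆ ∇
  ∇G⊆∇ (_ , _ , ((a∨b∈∇ , _) , _) , x≈a∨b) = ∇-upward a∨b∈∇ (≤-reflexive (sym x≈a∨b))

  ΔG⊆Δ : ΔG ∇ Δ ⊆ Δ
  ΔG⊆Δ (_ , _ , ((_ , a∧b∈Δ) , _) , x≈a∧b) = Δ-downward a∧b∈Δ (≤-reflexive x≈a∧b)

  G₂⇔TwSub : ∀ a b → G₂ ∇ Δ a b ⇔ TwSub (Γ ∇ Δ) (∇G ∇ Δ) (ΔG ∇ Δ) a b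
  G₂⇔TwSub a b = mk⇔
    (λ ab → (b , ab) , G₂-snd∈Γ ab , (a , b , ab , refl) , (a , b , ab , refl))
    (λ (a∈Γ , b∈Γ , a∨b∈∇G , a∧b∈ΔG) →
      (∇G⊆∇ a∨b∈∇G , ΔG⊆Δ a∧b∈ΔG) , Γ⊆G a∈Γ , Γ⊆G b∈Γ)

  module _ (Γ⊆Λ : Γ ∇ Δ ⊆ Λ ∇) where

    G₂-⇒ : ∀ {a b c d} → G₂ ∇ Δ a b → G₂ ∇ Δ c d → G₂ ∇ Δ (a ⇒G c) (a ∧ d)
    G₂-⇒ ab = G₂-⇒G (Γ⊆Λ (_ , ab))

    Γ-isSubalgebraG : IsSubalgebraG (Γ ∇ Δ)
    Γ-isSubalgebraG = record
      { ⊆G = Γ⊆G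
      ; ⊥∈ = ⊤ , G₂-⊥
      ; ∨∈ = λ (_ , ab) (_ , cd) → _ , G₂-∨ ab cd
      ; ∧∈ = λ (_ , ab) (_ , cd) → _ , G₂-∧ ab cd
      ; ⇒∈ = λ (_ , ab) (_ , cd) → _ , G₂-⇒ ab cd
      }

    G₂-isTwistOverΓ : IsTwistOver (Γ ∇ Δ) (G₂ ∇ Δ)
    G₂-isTwistOverΓ = record
      { ⊆C×C = λ ab → (_ , ab) , G₂-snd∈Γ ab
      ; π₁-onto = λ a∈Γ → a∈Γ
      ; ⊥∈ = G₂-⊥
      ; ∨∈ = G₂-∨
      ; ∧∈ = G₂-∧
      ; ⇒∈ = G₂-⇒
      ; ∼∈ = G₂-∼
      }

proposition3p1p5 : {c ℓ p : Level} (𝔹 : TBA c ℓ)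
    (∇ Δ : Pred (TBA.Carrier 𝔹) p) →
    TBA.IsOpenFilter 𝔹 ∇ → TBA.IsClosedIdeal 𝔹 Δ →
    (∀ a → TBA.Γ 𝔹 ∇ Δ a ⇔ TBA.Λ 𝔹 ∇ a) →
    TBA.IsSubalgebraG 𝔹 (TBA.Γ 𝔹 ∇ Δ)
    × TBA.IsTwistOver 𝔹 (TBA.Γ 𝔹 ∇ Δ) (TBA.G₂ 𝔹 ∇ Δ)
    × (∀ a b → TBA.G₂ 𝔹 ∇ Δ a b ⇔ TBA.TwSub 𝔹 (TBA.Γ 𝔹 ∇ Δ) (TBA.∇G 𝔹 ∇ Δ) (TBA.ΔG 𝔹 ∇ Δ) a b)
proposition3p1p5 𝔹 ∇ Δ ∇-isOpenFilter Δ-isClosedIdeal Γ⇔Λ =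
  Γ-isSubalgebraG Γ⊆Λ , G₂-isTwistOverΓ Γ⊆Λ , G₂⇔TwSub
  where
  open TBA 𝔹 using (Γ; Λ; module IsOpenFilter; module IsClosedIdeal)
  open TwistStructure 𝔹 (IsOpenFilter.isFilter ∇-isOpenFilter) (IsClosedIdeal.isIdeal Δ-isClosedIdeal)
  Γ⊆Λ : Γ ∇ Δ ⊆ Λ ∇
  Γ⊆Λ = Equivalence.to (Γ⇔Λ _)
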